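{- Let $F$ be a propositional formula over $n$ variables, and let $\Delta$ be an integer with $0\le \Delta\le 2^{n-1}$. Let $\psi^n(F)$ be the formula over the $2n+1$ variables $x_1,\dots,x_{2n+1}$ \[ F(x_1,\dots,x_n)\land\Big(\big(\neg F(x_{n+1},\dots,x_{2n})\land \neg x_{2n+1}\big)\lor\big(M^n_{2\Delta}(x_{n+1},\dots,x_{2n})\land x_{2n+1}\big)\Big), \] and let $K^n_\Delta(X)=X(2^n-X+2\Delta)$. Then $\psi^n(F)$ has size linear in the size of $F$, the number of models of $\psi^n(F)$ equals $K^n_\Delta(\#F)$, where $\#F$ denotes the number of models of $F$, and moreover $K^n_\Delta(\#F)\ge K^n_\Delta(2^{n-1}+\Delta)$ if and only if $\#F=2^{n-1}+\Delta$.
   Context: The size of a propositional formula is its number of Boolean operators; $\#F$ is its number of satisfying assignments over its $n$ variables. For $0\le c\le 2^n$, $M^n_c(x_0,\dots,x_{n-1})$ denotes a propositional formula of size linear in $n$ expressing $\sum_{i} 2^i x_i < c$ (so it has exactly $c$ models). -}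

module Defs where

open import Data.Nat using (ℕ; zero; suc; _+_; _*_; _∸_; _^_; _<_; _≤_)
open import Data.Product using (_×_)
open import Relation.Binary.PropositionalEquality using (_≡_)
open import Data.Bool using (Bool; true; false; not; _∧_; _∨_; if_then_else_)
open import Data.Fin using (Fin; zero; suc; _↑ˡ_; _↑ʳ_)
open import Data.Vec.Functional using (_∷_; tail)

data Formula (n : ℕ) : Set where
  var  : Fin n → Formula n
  cst  : Bool → Formula n
  ¬ᶠ_  : Formula n → Formula n
  _∧ᶠ_ : Formula n → Formula n → Formula n
  _∨ᶠ_ : Formula n → Formula n → Formula n

infixr 6 _∧ᶠ_
infixr 5 _∨ᶠ_
infix 7 ¬ᶠ_

Assignment : ℕ → Set
Assignment n = Fin n → Bool

eval : ∀ {n} → Formula n → Assignment n → Bool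
eval (var i)   ρ = ρ i
eval (cst b)   ρ = b
eval (¬ᶠ F)    ρ = not (eval F ρ)
eval (F ∧ᶠ G)  ρ = eval F ρ ∧ eval G ρ
eval (F ∨ᶠ G)  ρ = eval F ρ ∨ eval G ρ

size : ∀ {n} → Formula n → ℕ
size (var i)  = 0
size (cst b)  = 0
size (¬ᶠ F)   = suc (size F)
size (F ∧ᶠ G) = suc (size F + size G)
size (F ∨ᶠ G) = suc (size F + size G)

rename : ∀ {m n} → (Fin m → Fin n) → Formula m → Formula n
rename f (var i)  = var (f i)
rename f (cst b)  = cst b
rename f (¬ᶠ F)   = ¬ᶠ rename f F
rename f (F ∧ᶠ G) = rename f F ∧ᶠ rename f G
rename f (F ∨ᶠ G) = rename f F ∨ᶠ rename f G

countSat : (n : ℕ) → (Assignment n → Bool) → ℕ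
countSat zero    p = if p (λ ()) then 1 else 0
countSat (suc n) p = countSat n (λ ρ → p (false ∷ ρ)) + countSat n (λ ρ → p (true ∷ ρ))

#_ : ∀ {n} → Formula n → ℕ
#_ {n} F = countSat n (eval F)

b2n : Bool → ℕ
b2n false = 0
b2n true  = 1

-- value ∑ᵢ 2^i xᵢ of an assignment (x₀ = variable zero)
val : ∀ {n} → Assignment n → ℕ
val {zero}  ρ = 0
val {suc n} ρ = b2n (ρ zero) + 2 * val (tail ρ)

-- The variables x₁..x_{2n+1} of ψ: first block, second block, last variable.
blk₁ : ∀ {n} → Fin n → Fin ((n + n) + 1)
blk₁ {n} i = (i ↑ˡ n) ↑ˡ 1

blk₂ : ∀ {n} → Fin n → Fin ((n + n) + 1)
blk₂ {n} i = (n ↑ʳ i) ↑ˡ 1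

lastVar : ∀ {n} → Fin ((n + n) + 1)
lastVar {n} = (n + n) ↑ʳ zero

-- ψⁿ(F), parameterised by the comparator family M (M n c = M^n_c).
ψ : (M : (n c : ℕ) → Formula n) → (n Δ : ℕ) → Formula n → Formula ((n + n) + 1)
ψ M n Δ F =
  rename (blk₁ {n}) F ∧ᶠ
    ((¬ᶠ rename (blk₂ {n}) F ∧ᶠ ¬ᶠ var (lastVar {n}))
     ∨ᶠ (rename (blk₂ {n}) (M n (2 * Δ)) ∧ᶠ var (lastVar {n})))

-- K^n_Δ(X) = X (2^n − X + 2Δ)   (truncated subtraction; used only for X ≤ 2^n)
K : (n Δ X : ℕ) → ℕ
K n Δ X = X * ((2 ^ n ∸ X) + 2 * Δ)

record Comparator (M : (n c : ℕ) → Formula n) : Set where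
  field
    a b     : ℕ
    linSize : ∀ n c → size (M n c) ≤ a * n + b
    correct : ∀ n c → c ≤ 2 ^ n → ∀ ρ →
              (eval (M n c) ρ ≡ true → val ρ < c) × (val ρ < c → eval (M n c) ρ ≡ true)

{-# OPTIONS --safe #-}
-- Split an assignment of ψⁿ(F) as (ρ, σ, z).  Given F(ρ), the pair (σ, z) is a model of the
-- disjunction iff z = 0 and σ is a countermodel of F, or z = 1 and val σ < 2Δ; hence
-- #ψⁿ(F) = X (2ⁿ − X + 2Δ) with X = #F.  Writing t = 2ⁿ − X + 2Δ and h = 2ⁿ⁻¹ + Δ we have
-- X + t = 2h, so X t + (X − h)² = h² = K(h), and K(X) ≥ K(h) forces X = h.
module Submission where

open import Defs
open import Data.Nat using (ℕ; zero; suc; _+_; _*_; _∸_; _^_; _≤_; _≥_; _<_; _<?_; s≤s; ⌊_/2⌋; ⌈_/2⌉; ∣_-_∣)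
open import Data.Nat.Properties
open import Data.Nat.Tactic.RingSolver using (solve-∀)
open import Data.Bool using (Bool; true; false; not; _∧_; _∨_; if_then_else_)
open import Data.Bool.Properties using (not-¬)
open import Data.Fin using (Fin; zero; suc; _↑ˡ_; _↑ʳ_)
open import Data.Vec.Functional using (_∷_; tail)
open import Data.Product using (_×_; ∃; _,_; proj₁; proj₂)
open import Data.Sum using (inj₁; inj₂; [_,_]′)
open import Data.Empty using (⊥-elim)
open import Function using (_∘_; id)
open import Function.Bundles using (_⇔_; mk⇔)
open import Relation.Nullary using (does; yes; no)
open import Relation.Nullary.Decidable using (does-⇔; dec-true; dec-false)
open import Relation.Binary.PropositionalEquality
open import Algebra.Properties.CommutativeSemigroup +-commutativeSemigroup using (interchange)

∑ : (n : ℕ) → (Assignment n → ℕ) → ℕ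
∑ zero    f = f (λ ())
∑ (suc n) f = ∑ n (λ ρ → f (false ∷ ρ)) + ∑ n (λ ρ → f (true ∷ ρ))

∑-cong : ∀ n {f g : Assignment n → ℕ} → (∀ ρ → f ρ ≡ g ρ) → ∑ n f ≡ ∑ n g
∑-cong zero    f≗g = f≗g _
∑-cong (suc n) f≗g = cong₂ _+_ (∑-cong n (f≗g ∘ (false ∷_))) (∑-cong n (f≗g ∘ (true ∷_)))

∑-+ : ∀ n f g → ∑ n (λ ρ → f ρ + g ρ) ≡ ∑ n f + ∑ n g
∑-+ zero    f g = refl
∑-+ (suc n) f g = trans
  (cong₂ _+_ (∑-+ n (f ∘ (false ∷_)) (g ∘ (false ∷_))) (∑-+ n (f ∘ (true ∷_)) (g ∘ (true ∷_))))
  (interchange (∑ n (f ∘ (false ∷_))) (∑ n (g ∘ (false ∷_))) (∑ n (f ∘ (true ∷_))) (∑ n (g ∘ (true ∷_))))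

∑-*ˡ : ∀ n c f → ∑ n (λ ρ → c * f ρ) ≡ c * ∑ n f
∑-*ˡ zero    c f = refl
∑-*ˡ (suc n) c f = trans
  (cong₂ _+_ (∑-*ˡ n c (f ∘ (false ∷_))) (∑-*ˡ n c (f ∘ (true ∷_))))
  (sym (*-distribˡ-+ c _ _))

∑-*ʳ : ∀ n c f → ∑ n (λ ρ → f ρ * c) ≡ ∑ n f * c
∑-*ʳ n c f = trans (∑-cong n (λ ρ → *-comm (f ρ) c)) (trans (∑-*ˡ n c f) (*-comm c (∑ n f)))

∑-const-1 : ∀ n → ∑ n (λ _ → 1) ≡ 2 ^ n
∑-const-1 zero    = refl
∑-const-1 (suc n) = cong₂ _+_ (∑-const-1 n) (trans (∑-const-1 n) (sym (+-identityʳ (2 ^ n))))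

b2n+b2n-not : ∀ x → b2n x + b2n (not x) ≡ 1
b2n+b2n-not false = refl
b2n+b2n-not true  = refl

∑-b2n+∑-b2n-not : ∀ n (p : Assignment n → Bool) → ∑ n (b2n ∘ p) + ∑ n (b2n ∘ not ∘ p) ≡ 2 ^ n
∑-b2n+∑-b2n-not n p = trans (sym (∑-+ n _ _)) (trans (∑-cong n (b2n+b2n-not ∘ p)) (∑-const-1 n))

∑-b2n≤2^n : ∀ n (p : Assignment n → Bool) → ∑ n (b2n ∘ p) ≤ 2 ^ n
∑-b2n≤2^n n p = subst (∑ n (b2n ∘ p) ≤_) (∑-b2n+∑-b2n-not n p) (m≤m+n _ _)

∑-b2n-not : ∀ n (p : Assignment n → Bool) → ∑ n (b2n ∘ not ∘ p) ≡ 2 ^ n ∸ ∑ n (b2n ∘ p)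
∑-b2n-not n p = trans (sym (m+n∸m≡n (∑ n (b2n ∘ p)) _)) (cong (_∸ ∑ n (b2n ∘ p)) (∑-b2n+∑-b2n-not n p))

∷-cong : ∀ {n} b {ρ σ : Assignment n} → ρ ≗ σ → (b ∷ ρ) ≗ (b ∷ σ)
∷-cong b ρ≗σ zero    = refl
∷-cong b ρ≗σ (suc i) = ρ≗σ i

-- The hypothesis is needed because the absurd function λ () in the base case of countSat
-- is not definitionally equal to the one in the base case of ∑.
countSat≡∑ : ∀ n (p : Assignment n → Bool) → (∀ {ρ σ} → ρ ≗ σ → p ρ ≡ p σ) →
             countSat n p ≡ ∑ n (b2n ∘ p)
countSat≡∑ zero    p p-cong = trans (if-then-1-else-0 (p _)) (cong b2n (p-cong (λ ())))
  where
    if-then-1-else-0 : ∀ x → (if x then 1 else 0) ≡ b2n x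
    if-then-1-else-0 false = refl
    if-then-1-else-0 true  = refl
countSat≡∑ (suc n) p p-cong = cong₂ _+_
  (countSat≡∑ n (p ∘ (false ∷_)) (p-cong ∘ ∷-cong false))
  (countSat≡∑ n (p ∘ (true ∷_)) (p-cong ∘ ∷-cong true))

eval-cong : ∀ {n} (F : Formula n) {ρ σ : Assignment n} → ρ ≗ σ → eval F ρ ≡ eval F σ
eval-cong (var i)  ρ≗σ = ρ≗σ i
eval-cong (cst b)  ρ≗σ = refl
eval-cong (¬ᶠ F)   ρ≗σ = cong not (eval-cong F ρ≗σ)
eval-cong (F ∧ᶠ G) ρ≗σ = cong₂ _∧_ (eval-cong F ρ≗σ) (eval-cong G ρ≗σ)
eval-cong (F ∨ᶠ G) ρ≗σ = cong₂ _∨_ (eval-cong F ρ≗σ) (eval-cong G ρ≗σ)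

#≡∑ : ∀ {n} (F : Formula n) → # F ≡ ∑ n (b2n ∘ eval F)
#≡∑ {n} F = countSat≡∑ n (eval F) (eval-cong F)

#≤2^n : ∀ {n} (F : Formula n) → # F ≤ 2 ^ n
#≤2^n {n} F = subst (_≤ 2 ^ n) (sym (#≡∑ F)) (∑-b2n≤2^n n (eval F))

eval-rename : ∀ {m n} (f : Fin m → Fin n) (F : Formula m) τ → eval (rename f F) τ ≡ eval F (τ ∘ f)
eval-rename f (var i)  τ = refl
eval-rename f (cst b)  τ = refl
eval-rename f (¬ᶠ F)   τ = cong not (eval-rename f F τ)
eval-rename f (F ∧ᶠ G) τ = cong₂ _∧_ (eval-rename f F τ) (eval-rename f G τ)
eval-rename f (F ∨ᶠ G) τ = cong₂ _∨_ (eval-rename f F τ) (eval-rename f G τ)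

size-rename : ∀ {m n} (f : Fin m → Fin n) (F : Formula m) → size (rename f F) ≡ size F
size-rename f (var i)  = refl
size-rename f (cst b)  = refl
size-rename f (¬ᶠ F)   = cong suc (size-rename f F)
size-rename f (F ∧ᶠ G) = cong suc (cong₂ _+_ (size-rename f F) (size-rename f G))
size-rename f (F ∨ᶠ G) = cong suc (cong₂ _+_ (size-rename f F) (size-rename f G))

-- Defined by recursion, rather than as Data.Vec.Functional._++_, so that
-- (b ∷ ρ) ++ σ reduces to b ∷ (ρ ++ σ); this makes ∑-++ hold clause by clause.
_++_ : ∀ {m k} → Assignment m → Assignment k → Assignment (m + k)
_++_ {zero}  ρ σ = σ
_++_ {suc m} ρ σ = ρ zero ∷ (tail ρ ++ σ)

++-↑ˡ : ∀ {m k} (ρ : Assignment m) (σ : Assignment k) i → (ρ ++ σ) (i ↑ˡ k) ≡ ρ i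
++-↑ˡ ρ σ zero    = refl
++-↑ˡ ρ σ (suc i) = ++-↑ˡ (tail ρ) σ i

++-↑ʳ : ∀ {m k} (ρ : Assignment m) (σ : Assignment k) j → (ρ ++ σ) (m ↑ʳ j) ≡ σ j
++-↑ʳ {zero}  ρ σ j = refl
++-↑ʳ {suc m} ρ σ j = ++-↑ʳ (tail ρ) σ j

∑-++ : ∀ m k (f : Assignment (m + k) → ℕ) → ∑ (m + k) f ≡ ∑ m (λ ρ → ∑ k (λ σ → f (ρ ++ σ)))
∑-++ zero    k f = refl
∑-++ (suc m) k f = cong₂ _+_ (∑-++ m k (f ∘ (false ∷_))) (∑-++ m k (f ∘ (true ∷_)))

1+2*m<n⇔m<⌊n/2⌋ : ∀ m n → suc (2 * m) < n ⇔ m < ⌊ n /2⌋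
1+2*m<n⇔m<⌊n/2⌋ m n = mk⇔ to from
  where
    2*m≡m+m : 2 * m ≡ m + m
    2*m≡m+m = cong (m +_) (+-identityʳ m)
    to : suc (2 * m) < n → m < ⌊ n /2⌋
    to lt = subst (_≤ ⌊ n /2⌋) (cong suc (sym (trans (n≡⌊n+n/2⌋ m) (cong ⌊_/2⌋ (sym 2*m≡m+m)))))
                  (⌊n/2⌋-mono lt)
    from : m < ⌊ n /2⌋ → suc (2 * m) < n
    from lt with suc (2 * m) <? n
    ... | yes 1+2m<n = 1+2m<n
    ... | no  1+2m≮n = ⊥-elim (<⇒≱ lt
          (subst (⌊ n /2⌋ ≤_) (sym (trans (n≡⌈n+n/2⌉ m) (cong ⌈_/2⌉ (sym 2*m≡m+m))))
                 (⌊n/2⌋-mono (≮⇒≥ 1+2m≮n))))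

-- Splitting off the least significant bit, the assignments below n are those of the form
-- (0 ∷ ρ) with val ρ < ⌈n/2⌉ and (1 ∷ ρ) with val ρ < ⌊n/2⌋.
∑-val< : ∀ k n → n ≤ 2 ^ k → ∑ k (λ ρ → b2n (does (val ρ <? n))) ≡ n
∑-val< zero    zero          _           = refl
∑-val< zero    (suc zero)    _           = refl
∑-val< zero    (suc (suc n)) (s≤s ())
∑-val< (suc k) n             n≤2^[1+k]   = begin
    ∑ k (λ ρ → b2n (does (suc (2 * val ρ) <? suc n))) + ∑ k (λ ρ → b2n (does (suc (2 * val ρ) <? n)))
  ≡⟨ cong₂ _+_ (∑-odd< (suc n) ⌈n/2⌉≤2^k) (∑-odd< n (≤-trans (⌊n/2⌋≤⌈n/2⌉ n) ⌈n/2⌉≤2^k)) ⟩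
    ⌈ n /2⌉ + ⌊ n /2⌋
  ≡⟨ +-comm ⌈ n /2⌉ ⌊ n /2⌋ ⟩
    ⌊ n /2⌋ + ⌈ n /2⌉
  ≡⟨ ⌊n/2⌋+⌈n/2⌉≡n n ⟩
    n
  ∎
  where
    open ≡-Reasoning
    ⌈n/2⌉≤2^k : ⌈ n /2⌉ ≤ 2 ^ k
    ⌈n/2⌉≤2^k = subst (⌈ n /2⌉ ≤_)
      (sym (trans (n≡⌈n+n/2⌉ (2 ^ k)) (cong ⌈_/2⌉ (cong (2 ^ k +_) (sym (+-identityʳ (2 ^ k)))))))
      (⌈n/2⌉-mono n≤2^[1+k])
    ∑-odd< : ∀ m → ⌊ m /2⌋ ≤ 2 ^ k → ∑ k (λ ρ → b2n (does (suc (2 * val ρ) <? m))) ≡ ⌊ m /2⌋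
    ∑-odd< m ⌊m/2⌋≤2^k = trans
      (∑-cong k (λ ρ → cong b2n (does-⇔ (1+2*m<n⇔m<⌊n/2⌋ (val ρ) m) (suc (2 * val ρ) <? m) (val ρ <? ⌊ m /2⌋))))
      (∑-val< k ⌊ m /2⌋ ⌊m/2⌋≤2^k)

#M≡c : ∀ {M} → Comparator M → ∀ n c → c ≤ 2 ^ n → # (M n c) ≡ c
#M≡c {M} C n c c≤2^n = trans (#≡∑ (M n c))
  (trans (∑-cong n (λ ρ → cong b2n (eval≡does ρ))) (∑-val< n c c≤2^n))
  where
    open Comparator C using (correct)
    eval≡does : ∀ ρ → eval (M n c) ρ ≡ does (val ρ <? c)
    eval≡does ρ with eval (M n c) ρ in eq
    ... | true  = sym (dec-true (val ρ <? c) (proj₁ (correct n c c≤2^n ρ) eq))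
    ... | false = sym (dec-false (val ρ <? c) (not-¬ eq ∘ proj₂ (correct n c c≤2^n ρ)))

∑-switch : ∀ x y z → ∑ 1 (λ β → b2n (x ∧ ((y ∧ not (β zero)) ∨ (z ∧ β zero)))) ≡ b2n x * (b2n y + b2n z)
∑-switch false y     z     = refl
∑-switch true  false false = refl
∑-switch true  false true  = refl
∑-switch true  true  false = refl
∑-switch true  true  true  = refl

module _ (M : (n c : ℕ) → Formula n) (n Δ : ℕ) (F : Formula n) where

  eval-ψ : ∀ ρ σ (β : Assignment 1) → eval (ψ M n Δ F) ((ρ ++ σ) ++ β)
         ≡ eval F ρ ∧ ((not (eval F σ) ∧ not (β zero)) ∨ (eval (M n (2 * Δ)) σ ∧ β zero))
  eval-ψ ρ σ β = cong₂ _∧_ (on-blk₁ F)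
    (cong₂ _∨_ (cong₂ _∧_ (cong not (on-blk₂ F)) (cong not on-lastVar)) (cong₂ _∧_ (on-blk₂ (M n (2 * Δ))) on-lastVar))
    where
      τ = (ρ ++ σ) ++ β
      on-blk₁ : ∀ G → eval (rename blk₁ G) τ ≡ eval G ρ
      on-blk₁ G = trans (eval-rename blk₁ G τ)
        (eval-cong G (λ i → trans (++-↑ˡ (ρ ++ σ) β (i ↑ˡ n)) (++-↑ˡ ρ σ i)))
      on-blk₂ : ∀ G → eval (rename blk₂ G) τ ≡ eval G σ
      on-blk₂ G = trans (eval-rename blk₂ G τ)
        (eval-cong G (λ i → trans (++-↑ˡ (ρ ++ σ) β (n ↑ʳ i)) (++-↑ʳ ρ σ i)))
      on-lastVar : τ (lastVar {n}) ≡ β zero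
      on-lastVar = ++-↑ʳ (ρ ++ σ) β zero

  #ψ≡ : # (ψ M n Δ F) ≡ # F * ((2 ^ n ∸ # F) + # (M n (2 * Δ)))
  #ψ≡ = begin
      # (ψ M n Δ F)
    ≡⟨ #≡∑ (ψ M n Δ F) ⟩
      ∑ ((n + n) + 1) (b2n ∘ eval (ψ M n Δ F))
    ≡⟨ trans (∑-++ (n + n) 1 _) (∑-++ n n _) ⟩
      ∑ n (λ ρ → ∑ n (λ σ → ∑ 1 (λ β → b2n (eval (ψ M n Δ F) ((ρ ++ σ) ++ β)))))
    ≡⟨ ∑-cong n (λ ρ → ∑-cong n (λ σ → trans (∑-cong 1 (cong b2n ∘ eval-ψ ρ σ))
                                              (∑-switch (eval F ρ) (not (eval F σ)) (eval Mc σ)))) ⟩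
      ∑ n (λ ρ → ∑ n (λ σ → b2n (eval F ρ) * (b2n (not (eval F σ)) + b2n (eval Mc σ))))
    ≡⟨ ∑-cong n (λ ρ → ∑-*ˡ n (b2n (eval F ρ)) _) ⟩
      ∑ n (λ ρ → b2n (eval F ρ) * ∑ n (λ σ → b2n (not (eval F σ)) + b2n (eval Mc σ)))
    ≡⟨ ∑-*ʳ n _ (b2n ∘ eval F) ⟩
      ∑ n (b2n ∘ eval F) * ∑ n (λ σ → b2n (not (eval F σ)) + b2n (eval Mc σ))
    ≡⟨ cong₂ _*_ (sym (#≡∑ F)) (∑-+ n _ _) ⟩
      # F * (∑ n (b2n ∘ not ∘ eval F) + ∑ n (b2n ∘ eval Mc))
    ≡⟨ cong (λ x → # F * (x + ∑ n (b2n ∘ eval Mc))) (∑-b2n-not n (eval F)) ⟩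
      # F * ((2 ^ n ∸ ∑ n (b2n ∘ eval F)) + ∑ n (b2n ∘ eval Mc))
    ≡⟨ sym (cong₂ (λ x y → # F * ((2 ^ n ∸ x) + y)) (#≡∑ F) (#≡∑ Mc)) ⟩
      # F * ((2 ^ n ∸ # F) + # Mc)
    ∎
    where
      open ≡-Reasoning
      Mc = M n (2 * Δ)

size-ψ : ∀ M n Δ (F : Formula n) → size (ψ M n Δ F) ≡ 2 * size F + size (M n (2 * Δ)) + 6
size-ψ M n Δ F
  rewrite size-rename (blk₁ {n}) F | size-rename (blk₂ {n}) F | size-rename (blk₂ {n}) (M n (2 * Δ))
  = normalise (size F) (size (M n (2 * Δ)))
  where
    normalise : ∀ s t → suc (s + suc (suc (suc s + 1) + suc (t + 0))) ≡ 2 * s + t + 6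
    normalise = solve-∀

size-ψ≤ : ∀ {M} (C : Comparator M) n Δ (F : Formula n) →
          size (ψ M n Δ F) ≤ (6 + Comparator.a C + Comparator.b C) * (size F + n + 1)
size-ψ≤ {M} C n Δ F = begin
    size (ψ M n Δ F)                      ≡⟨ size-ψ M n Δ F ⟩
    2 * size F + size (M n (2 * Δ)) + 6   ≡⟨ rearrange (size F) (size (M n (2 * Δ))) ⟩
    (2 * size F + 6) + size (M n (2 * Δ)) ≤⟨ +-mono-≤ 2s+6≤6S sizeM≤ ⟩
    6 * S + (a * S + b * S)               ≡⟨ factor a b S ⟩
    (6 + a + b) * S                       ∎
  where
    open ≤-Reasoning
    open Comparator C using (a; b; linSize)
    S = size F + n + 1
    rearrange : ∀ s t → 2 * s + t + 6 ≡ (2 * s + 6) + t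
    rearrange = solve-∀
    factor : ∀ a b S → 6 * S + (a * S + b * S) ≡ (6 + a + b) * S
    factor = solve-∀
    six-copies : ∀ s n → 6 * (s + n + 1) ≡ (2 * s + 6) + (4 * s + 6 * n)
    six-copies = solve-∀
    2s+6≤6S : 2 * size F + 6 ≤ 6 * S
    2s+6≤6S = subst (2 * size F + 6 ≤_) (sym (six-copies (size F) n)) (m≤m+n _ _)
    sizeM≤ : size (M n (2 * Δ)) ≤ a * S + b * S
    sizeM≤ = ≤-trans (linSize n (2 * Δ))
      (+-mono-≤ (*-monoʳ-≤ a (≤-trans (m≤n+m n (size F)) (m≤m+n _ 1)))
                (subst (_≤ b * S) (*-identityʳ b) (*-monoʳ-≤ b (m≤n+m 1 _))))

x*t+∣x-h∣²≡h² : ∀ {x t h} → x + t ≡ h + h → x * t + ∣ x - h ∣ * ∣ x - h ∣ ≡ h * h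
x*t+∣x-h∣²≡h² {x} {t} {h} x+t≡h+h with ≤-total x h
... | inj₁ x≤h with m≤n⇒∃[o]m+o≡n x≤h
...   | d , refl = begin
        x * t + ∣ x - x + d ∣ * ∣ x - x + d ∣ ≡⟨ cong₂ (λ u e → x * u + e * e) t≡x+d+d (∣m-m+n∣≡n x d) ⟩
        x * (x + d + d) + d * d              ≡⟨ square-identity x d ⟩
        (x + d) * (x + d)                    ∎
  where
    open ≡-Reasoning
    double : ∀ x d → (x + d) + (x + d) ≡ x + (x + d + d)
    double = solve-∀
    square-identity : ∀ x d → x * (x + d + d) + d * d ≡ (x + d) * (x + d)
    square-identity = solve-∀
    t≡x+d+d : t ≡ x + d + d
    t≡x+d+d = +-cancelˡ-≡ x t _ (trans x+t≡h+h (double x d))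
x*t+∣x-h∣²≡h² {x} {t} {h} x+t≡h+h | inj₂ h≤x with m≤n⇒∃[o]m+o≡n h≤x
...   | d , refl = begin
        (h + d) * t + ∣ h + d - h ∣ * ∣ h + d - h ∣ ≡⟨ cong (λ e → (h + d) * t + e * e) (trans (∣-∣-comm (h + d) h) (∣m-m+n∣≡n h d)) ⟩
        (h + d) * t + d * d                         ≡⟨ cong (λ u → (u + d) * t + d * d) h≡t+d ⟩
        (t + d + d) * t + d * d                     ≡⟨ square-identity t d ⟩
        (t + d) * (t + d)                           ≡⟨ cong (λ u → u * u) (sym h≡t+d) ⟩
        h * h                                       ∎
  where
    open ≡-Reasoning
    square-identity : ∀ t d → (t + d + d) * t + d * d ≡ (t + d) * (t + d)
    square-identity = solve-∀
    rotate : ∀ h d t → h + d + t ≡ h + (t + d)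
    rotate = solve-∀
    h≡t+d : h ≡ t + d
    h≡t+d = sym (+-cancelˡ-≡ h (t + d) h (trans (sym (rotate h d t)) x+t≡h+h))

h*h≤x*t⇒x≡h : ∀ {x t h} → x + t ≡ h + h → h * h ≤ x * t → x ≡ h
h*h≤x*t⇒x≡h {x} {t} {h} x+t≡h+h h*h≤x*t =
  ∣m-n∣≡0⇒m≡n ([ id , id ]′ (m*n≡0⇒m≡0∨n≡0 ∣ x - h ∣ ∣x-h∣²≡0))
  where
    ∣x-h∣²≡0 : ∣ x - h ∣ * ∣ x - h ∣ ≡ 0
    ∣x-h∣²≡0 = n≤0⇒n≡0 (+-cancelˡ-≤ (x * t) _ 0
      (subst₂ _≤_ (sym (x*t+∣x-h∣²≡h² {x} {t} {h} x+t≡h+h)) (sym (+-identityʳ (x * t))) h*h≤x*t))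

[2P∸[P+Δ]]+2Δ≡P+Δ : ∀ {P Δ} → Δ ≤ P → (2 * P ∸ (P + Δ)) + 2 * Δ ≡ P + Δ
[2P∸[P+Δ]]+2Δ≡P+Δ {P} {Δ} Δ≤P = begin
    (2 * P ∸ (P + Δ)) + 2 * Δ  ≡⟨ cong (_+ 2 * Δ) ([m+n]∸[m+o]≡n∸o P (P + 0) Δ) ⟩
    ((P + 0) ∸ Δ) + 2 * Δ      ≡⟨ cong (λ u → (u ∸ Δ) + 2 * Δ) (+-identityʳ P) ⟩
    (P ∸ Δ) + (Δ + (Δ + 0))    ≡⟨ +-assoc (P ∸ Δ) Δ (Δ + 0) ⟨
    ((P ∸ Δ) + Δ) + (Δ + 0)    ≡⟨ cong (_+ (Δ + 0)) (m∸n+n≡m Δ≤P) ⟩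
    P + (Δ + 0)                ≡⟨ cong (P +_) (+-identityʳ Δ) ⟩
    P + Δ                      ∎
  where open ≡-Reasoning

X+[2P∸X+2Δ]≡2[P+Δ] : ∀ {P X} Δ → X ≤ 2 * P → X + ((2 * P ∸ X) + 2 * Δ) ≡ (P + Δ) + (P + Δ)
X+[2P∸X+2Δ]≡2[P+Δ] {P} {X} Δ X≤2P =
  trans (sym (+-assoc X _ _)) (trans (cong (_+ 2 * Δ) (m+[n∸m]≡n X≤2P)) (regroup P Δ))
  where
    regroup : ∀ p d → 2 * p + 2 * d ≡ (p + d) + (p + d)
    regroup = solve-∀

K≥K-peak⇔≡peak : ∀ m Δ X → Δ ≤ 2 ^ m → X ≤ 2 ^ suc m →
                 (K (suc m) Δ X ≥ K (suc m) Δ (2 ^ m + Δ)) ⇔ (X ≡ 2 ^ m + Δ)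
K≥K-peak⇔≡peak m Δ X Δ≤2^m X≤2^[1+m] = mk⇔
  (λ K≥ → h*h≤x*t⇒x≡h {X} {_} {2 ^ m + Δ} (X+[2P∸X+2Δ]≡2[P+Δ] {2 ^ m} Δ X≤2^[1+m])
             (subst (λ u → (2 ^ m + Δ) * u ≤ K (suc m) Δ X) ([2P∸[P+Δ]]+2Δ≡P+Δ Δ≤2^m) K≥))
  (λ { refl → ≤-refl })

mainTheorem3 : (M : (n c : ℕ) → Formula n) → Comparator M →
    (∃ λ k → ∀ n Δ (F : Formula n) → size (ψ M n Δ F) ≤ k * (size F + n + 1))
    × (∀ n Δ (F : Formula n) → 1 ≤ n → Δ ≤ 2 ^ (n ∸ 1) →
        (# (ψ M n Δ F) ≡ K n Δ (# F))
        × ((K n Δ (# F) ≥ K n Δ (2 ^ (n ∸ 1) + Δ)) ⇔ (# F ≡ 2 ^ (n ∸ 1) + Δ)))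
mainTheorem3 M C = (6 + Comparator.a C + Comparator.b C , size-ψ≤ C) , counting
  where
    counting : ∀ n Δ (F : Formula n) → 1 ≤ n → Δ ≤ 2 ^ (n ∸ 1) →
        (# (ψ M n Δ F) ≡ K n Δ (# F))
        × ((K n Δ (# F) ≥ K n Δ (2 ^ (n ∸ 1) + Δ)) ⇔ (# F ≡ 2 ^ (n ∸ 1) + Δ))
    counting (suc m) Δ F _ Δ≤2^m =
        trans (#ψ≡ M (suc m) Δ F) (cong (λ c → # F * ((2 ^ suc m ∸ # F) + c)) #M≡2Δ)
      , K≥K-peak⇔≡peak m Δ (# F) Δ≤2^m (#≤2^n F)
      where
        #M≡2Δ : # (M (suc m) (2 * Δ)) ≡ 2 * Δ
        #M≡2Δ = #M≡c C (suc m) (2 * Δ) (*-monoʳ-≤ 2 Δ≤2^m)
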